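{- A rooted labeled forest that avoids the pattern $132$ avoids the pattern $2314$ if and only if it is a $P_1$-forest.
   Context: Rooted labeled forest: an unordered forest whose components have distinguished roots and whose vertices carry distinct integer labels $L(v)$. An instance of a pattern $\pi$ of length $k$ (a permutation of $[k]$) is a sequence $v_1,\dots,v_k$ of vertices with $v_i$ a strict ancestor of $v_{i+1}$ and $L(v_1),\dots,L(v_k)$ in the same relative order as $\pi$; avoiding means having no instance. Ancestors of $v$ include $v$ itself. A vertex $v$ is a top-down minimum (TDM) if $L(u)\ge L(v)$ for all ancestors $u$ of $v$; otherwise it is non-TDM. A non-TDM vertex $v$ is special if the path from the root of its component to $v$ contains vertices $v_1,v_2,v_3,v_4$ in that order (not necessarily consecutive) with $v_1,v_3$ TDM and $v_2,v_4$ non-TDM. The ceiling of a special vertex $v$ is its lowest (deepest) ancestor $u$ such that the path from $u$ to $v$ contains vertices $v_1,v_2,v_3,v_4$ in that order with $v_1,v_3$ TDM and $v_2,v_4$ non-TDM. A $P_1$-forest is a forest in which every special vertex $v$ with ceiling $u$ satisfies $L(u)>L(v)$. -}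

module Defs where

open import Data.Nat using (ℕ; suc)
open import Data.Integer using (ℤ; _≤_; _<_)
import Data.Nat as N
open import Data.Fin using (Fin; toℕ)
open import Data.List using (List; length; lookup)
open import Data.Vec using (Vec)
import Data.Vec as V
open import Data.Product using (Σ; ∃; _×_; _,_)
open import Relation.Binary.PropositionalEquality using (_≡_; _≢_)
open import Relation.Nullary using (¬_)
open import Function.Bundles using (_⇔_)
open import Function.Definitions using (Injective)

-- Rooted trees with integer labels; a forest is a finite list of trees.
-- (The order of children / of components is irrelevant for every notion below.)
data Tree : Set where
  node : ℤ → List Tree → Tree

Forest : Set
Forest = List Tree

data TVert : Tree → Set where
  root : ∀ {a ts} → TVert (node a ts)
  down : ∀ {a ts} (i : Fin (length ts)) → TVert (lookup ts i) → TVert (node a ts)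

tlabel : {t : Tree} → TVert t → ℤ
tlabel {node a ts} root       = a
tlabel {node a ts} (down i p) = tlabel p

data _≼ᵗ_ : {t : Tree} → TVert t → TVert t → Set where
  root≼ : ∀ {a ts} {q : TVert (node a ts)} → root ≼ᵗ q
  down≼ : ∀ {a ts} {i : Fin (length ts)} {p q : TVert (lookup ts i)} →
          p ≼ᵗ q → down {a} {ts} i p ≼ᵗ down i q

data Vert (F : Forest) : Set where
  vin : (i : Fin (length F)) → TVert (lookup F i) → Vert F

L : {F : Forest} → Vert F → ℤ
L (vin i p) = tlabel p

data _≼_ {F : Forest} : Vert F → Vert F → Set where
  in≼ : ∀ {i} {p q : TVert (lookup F i)} → p ≼ᵗ q → vin i p ≼ vin i q

_≺_ : {F : Forest} → Vert F → Vert F → Set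
u ≺ v = u ≼ v × u ≢ v

DistinctLabels : Forest → Set
DistinctLabels F = Injective _≡_ _≡_ (L {F})

-- A pattern of length k is given by its one-line notation π(1)…π(k).
-- An instance: v₁,…,vₖ with vᵢ a strict ancestor of vᵢ₊₁ and labels
-- order-isomorphic to π.
Instance : (F : Forest) {k : ℕ} → Vec ℕ k → (Fin k → Vert F) → Set
Instance F {k} π v =
  (∀ (i j : Fin k) → toℕ j ≡ suc (toℕ i) → v i ≺ v j) ×
  (∀ (i j : Fin k) → (L (v i) < L (v j)) ⇔ (V.lookup π i N.< V.lookup π j))

Avoids : Forest → {k : ℕ} → Vec ℕ k → Set
Avoids F {k} π = ¬ (Σ (Fin k → Vert F) (Instance F π))

p132 : Vec ℕ 3
p132 = 1 V.∷ 3 V.∷ 2 V.∷ V.[]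

p2314 : Vec ℕ 4
p2314 = 2 V.∷ 3 V.∷ 1 V.∷ 4 V.∷ V.[]

TDM : {F : Forest} → Vert F → Set
TDM {F} v = ∀ (u : Vert F) → u ≼ v → L v ≤ L u

PatternBelow : {F : Forest} → Vert F → Vert F → Set
PatternBelow {F} u v =
  Σ (Vert F) λ v₁ → Σ (Vert F) λ v₂ → Σ (Vert F) λ v₃ → Σ (Vert F) λ v₄ →
    u ≼ v₁ × v₁ ≺ v₂ × v₂ ≺ v₃ × v₃ ≺ v₄ × v₄ ≼ v ×
    TDM v₁ × ¬ TDM v₂ × TDM v₃ × ¬ TDM v₄

rootOf : {F : Forest} → Vert F → Vert F
rootOf (vin i p) = vin i (rootT p)
  where
  rootT : {t : Tree} → TVert t → TVert t
  rootT {node a ts} _ = root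

Special : {F : Forest} → Vert F → Set
Special v = ¬ TDM v × PatternBelow (rootOf v) v

Ceiling : {F : Forest} → Vert F → Vert F → Set
Ceiling {F} u v =
  u ≼ v × PatternBelow u v × (∀ (w : Vert F) → w ≼ v → PatternBelow w v → w ≼ u)

P₁Forest : Forest → Set
P₁Forest F = ∀ (v u : Vert F) → Special v → Ceiling u v → L v < L u

-- Every vertex has an ancestor of minimal label, and that ancestor is TDM.
-- (⇒) Let u be the ceiling of v, with pattern u v₂ v₃ v₄. The minimal ancestor of v₂ starts
-- another pattern ending above v, so it lies above u and L u < L v₂; also L v₃ < L u since v₃
-- is TDM. If L u < L v, avoiding 132 at u v₂ v forces L v₂ < L v, and then u v₂ v₃ v is an
-- occurrence of 2314.
-- (⇐) For an occurrence a b c d of 2314 let m and t be the minimal ancestors of a and c.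
-- Avoiding 132 at t b c puts t strictly below b, so m b t d is a pattern and d is special.
-- The ceiling u of d is TDM and lies below m, whence L u ≤ L m ≤ L a < L d, against P₁.

module Submission where

open import Defs
open import Data.Nat as ℕ using (ℕ; suc; s≤s; _≤′_; ≤′-refl; ≤′-step)
import Data.Nat.Properties as ℕP
open import Data.Integer using (ℤ; _≤_; _<_; _≤?_)
import Data.Integer.Properties as ℤP
open import Data.Fin as Fin using (Fin; toℕ)
open import Data.Fin.Patterns using (0F; 1F; 2F; 3F)
open import Data.List using (length; lookup; _∷_)
open import Data.Vec as V using (Vec)
open import Data.Vec.Properties using (lookup-map)
open import Data.Vec.Relation.Unary.All using (All; all?)
import Data.Vec.Relation.Unary.All.Properties as Allₚ
open import Data.Vec.Relation.Unary.Linked using (Linked; _∷_; [-])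
open import Data.Vec.Relation.Unary.Linked.Properties using (lookup⁺)
open import Data.Product using (Σ; _×_; _,_; proj₁; proj₂)
open import Data.Sum as Sum using (_⊎_; inj₁; inj₂)
open import Data.Empty using (⊥-elim)
open import Function using (_∘_)
open import Function.Bundles using (_⇔_; mk⇔; Equivalence)
open import Relation.Nullary using (¬_; yes; no; ¬?)
open import Relation.Nullary.Decidable using (from-yes; _×-dec_; map′)
open import Relation.Unary using (Decidable)
open import Relation.Binary.Definitions using (tri<; tri≈; tri>)
open import Relation.Binary.PropositionalEquality using (_≡_; _≢_; refl; sym; cong; subst₂)

record DeepestBelow {V : Set} (_⊑_ _⊏_ : V → V → Set) (P : V → Set) (v : V) : Set where
  field
    vertex  : V
    below   : vertex ⊏ v
    holds   : P vertex
    deepest : ∀ {w} → w ⊏ v → P w → w ⊑ vertex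

private variable
  t : Tree

_≺ᵗ_ : TVert t → TVert t → Set
p ≺ᵗ q = p ≼ᵗ q × p ≢ q

≼ᵗ-refl : (p : TVert t) → p ≼ᵗ p
≼ᵗ-refl root       = root≼
≼ᵗ-refl (down i p) = down≼ (≼ᵗ-refl p)

≼ᵗ-trans : {p q r : TVert t} → p ≼ᵗ q → q ≼ᵗ r → p ≼ᵗ r
≼ᵗ-trans root≼     _          = root≼
≼ᵗ-trans (down≼ h) (down≼ h′) = down≼ (≼ᵗ-trans h h′)

≼ᵗ-antisym : {p q : TVert t} → p ≼ᵗ q → q ≼ᵗ p → p ≡ q
≼ᵗ-antisym root≼     root≼      = refl
≼ᵗ-antisym (down≼ h) (down≼ h′) = cong (down _) (≼ᵗ-antisym h h′)

≼ᵗ-comparable : {p q r : TVert t} → p ≼ᵗ r → q ≼ᵗ r → p ≼ᵗ q ⊎ q ≼ᵗ p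
≼ᵗ-comparable root≼     _          = inj₁ root≼
≼ᵗ-comparable (down≼ _) root≼      = inj₂ root≼
≼ᵗ-comparable (down≼ h) (down≼ h′) = Sum.map down≼ down≼ (≼ᵗ-comparable h h′)

minAncestorᵗ : (q : TVert t) → Σ (TVert t) λ m → m ≼ᵗ q × (∀ p → p ≼ᵗ q → tlabel m ≤ tlabel p)
minAncestorᵗ {node _ _} root = root , root≼ , λ { _ root≼ → ℤP.≤-refl }
minAncestorᵗ {node a _} (down i q) with minAncestorᵗ q
... | m , m≼q , m-min with a ≤? tlabel m
...   | yes a≤m = root , root≼ , λ { _ root≼ → ℤP.≤-refl ; _ (down≼ h) → ℤP.≤-trans a≤m (m-min _ h) }
...   | no a≰m  = down i m , down≼ m≼q ,
                  λ { _ root≼ → ℤP.<⇒≤ (ℤP.≰⇒> a≰m) ; _ (down≼ h) → m-min _ h }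

deepestᵗ : {P : TVert t → Set} → Decidable P → (q : TVert t) →
  DeepestBelow _≼ᵗ_ _≺ᵗ_ P q ⊎ (∀ {p} → p ≺ᵗ q → ¬ P p)
deepestᵗ {node _ _} P? root = inj₂ λ { (root≼ , root≢root) _ → root≢root refl }
deepestᵗ {node _ _} P? (down i q) with deepestᵗ (P? ∘ down i) q
... | inj₁ d = inj₁ record
  { vertex  = down i vertex
  ; below   = down≼ (proj₁ below) , λ { refl → proj₂ below refl }
  ; holds   = holds
  ; deepest = λ { (root≼ , _) _ → root≼ ; (down≼ h , ≢q) Pw → down≼ (deepest (h , ≢q ∘ cong (down i)) Pw) }
  }
  where open DeepestBelow d
... | inj₂ none with P? root
...   | yes P-root = inj₁ record
  { vertex  = root
  ; below   = root≼ , λ ()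
  ; holds   = P-root
  ; deepest = λ { (root≼ , _) _ → root≼ ; (down≼ h , ≢q) Pw → ⊥-elim (none (h , ≢q ∘ cong (down i)) Pw) }
  }
...   | no ¬P-root = inj₂ λ { (root≼ , _) → ¬P-root ; (down≼ h , ≢q) → none (h , ≢q ∘ cong (down i)) }

-- Recursion on F is needed only to make lookup F i a node, so that rootOf computes.
rootOf-≼′ : (F : Forest) (i : Fin (length F)) (p q : TVert (lookup F i)) → rootOf {F} (vin i q) ≼ vin i p
rootOf-≼′ (node _ _ ∷ F) Fin.zero    p q = in≼ root≼
rootOf-≼′ (_ ∷ F)        (Fin.suc i) p q with rootOf-≼′ F i p q
... | in≼ h = in≼ h

module _ {F : Forest} where

  ≼-refl : (v : Vert F) → v ≼ v
  ≼-refl (vin i p) = in≼ (≼ᵗ-refl p)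

  ≼-trans : {u v w : Vert F} → u ≼ v → v ≼ w → u ≼ w
  ≼-trans (in≼ h) (in≼ h′) = in≼ (≼ᵗ-trans h h′)

  ≼-antisym : {u v : Vert F} → u ≼ v → v ≼ u → u ≡ v
  ≼-antisym (in≼ h) (in≼ h′) = cong (vin _) (≼ᵗ-antisym h h′)

  ≼-comparable : {u v w : Vert F} → u ≼ w → v ≼ w → u ≼ v ⊎ v ≼ u
  ≼-comparable (in≼ h) (in≼ h′) = Sum.map in≼ in≼ (≼ᵗ-comparable h h′)

  ≺⇒≼ : {u v : Vert F} → u ≺ v → u ≼ v
  ≺⇒≼ = proj₁

  ≺-≼-trans : {u v w : Vert F} → u ≺ v → v ≼ w → u ≺ w
  ≺-≼-trans (u≼v , u≢v) v≼w = ≼-trans u≼v v≼w , λ { refl → u≢v (≼-antisym u≼v v≼w) }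

  ≼-≺-trans : {u v w : Vert F} → u ≼ v → v ≺ w → u ≺ w
  ≼-≺-trans u≼v (v≼w , v≢w) = ≼-trans u≼v v≼w , λ { refl → v≢w (≼-antisym v≼w u≼v) }

  ≺-trans : {u v w : Vert F} → u ≺ v → v ≺ w → u ≺ w
  ≺-trans u≺v v≺w = ≺-≼-trans u≺v (≺⇒≼ v≺w)

  <⇒≺ : {u v : Vert F} → u ≼ v → L u < L v → u ≺ v
  <⇒≺ u≼v Lu<Lv = u≼v , λ { refl → ℤP.<-irrefl refl Lu<Lv }

  rootOf-≼ : {u v : Vert F} → u ≼ v → rootOf v ≼ u
  rootOf-≼ (in≼ {i} {p} {q} _) = rootOf-≼′ F i p q

  record MinAncestor (v : Vert F) : Set where
    field
      vertex   : Vert F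
      vertex≼v : vertex ≼ v
      minimal  : ∀ u → u ≼ v → L vertex ≤ L u

    vertex-TDM : TDM vertex
    vertex-TDM u u≼m = minimal u (≼-trans u≼m vertex≼v)

    ≤vertex⇒TDM : L v ≤ L vertex → TDM v
    ≤vertex⇒TDM v≤m u u≼v = ℤP.≤-trans v≤m (minimal u u≼v)

  minAncestor : (v : Vert F) → MinAncestor v
  minAncestor (vin i q) with minAncestorᵗ q
  ... | m , m≼q , m-min = record
    { vertex = vin i m ; vertex≼v = in≼ m≼q ; minimal = λ { _ (in≼ h) → m-min _ h } }

  TDM? : Decidable (TDM {F})
  TDM? v = map′ ≤vertex⇒TDM (λ tdm → tdm vertex vertex≼v) (L v ≤? L vertex)
    where open MinAncestor (minAncestor v)

  TDM-ancestor : (v : Vert F) → Σ (Vert F) λ m → m ≼ v × TDM m × L m ≤ L v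
  TDM-ancestor v = vertex , vertex≼v , vertex-TDM , minimal v (≼-refl v)
    where open MinAncestor (minAncestor v)

  ¬TDM⇒smaller-TDM-ancestor : {v : Vert F} → ¬ TDM v → Σ (Vert F) λ m → m ≺ v × TDM m × L m < L v
  ¬TDM⇒smaller-TDM-ancestor {v} ¬tdm = vertex , <⇒≺ vertex≼v m<v , vertex-TDM , m<v
    where
    open MinAncestor (minAncestor v)
    m<v : L vertex < L v
    m<v = ℤP.≰⇒> (¬tdm ∘ ≤vertex⇒TDM)

  deepestBelow : {P : Vert F → Set} → Decidable P → {v w : Vert F} → w ≺ v → P w →
    DeepestBelow _≼_ _≺_ P v
  deepestBelow P? {vin i q} w≺v Pw with deepestᵗ (P? ∘ vin i) q
  ... | inj₁ d = record
    { vertex  = vin i vertex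
    ; below   = in≼ (proj₁ below) , λ { refl → proj₂ below refl }
    ; holds   = holds
    ; deepest = λ { (in≼ h , ≢v) Pw → in≼ (deepest (h , ≢v ∘ cong (vin i)) Pw) }
    }
    where open DeepestBelow d
  ... | inj₂ none with w≺v
  ...   | in≼ h , ≢v = ⊥-elim (none (h , ≢v ∘ cong (vin i)) Pw)

  smaller-ancestor⇒¬TDM : {u v : Vert F} → u ≼ v → L u < L v → ¬ TDM v
  smaller-ancestor⇒¬TDM u≼v u<v tdm = ℤP.<⇒≱ u<v (tdm _ u≼v)

module _ {k : ℕ} (h : ℕ → ℤ) (step : ∀ {r} → 1 ℕ.≤ r → suc r ℕ.≤ k → h r < h (suc r)) where

  rank-mono : ∀ {m n} → 1 ℕ.≤ m → m ℕ.< n → n ℕ.≤ k → h m < h n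
  rank-mono {m} 1≤m m<n = go (ℕP.≤⇒≤′ m<n)
    where
    go : ∀ {n} → suc m ≤′ n → n ℕ.≤ k → h m < h n
    go ≤′-refl          n≤k = step 1≤m n≤k
    go (≤′-step {n} m<n) n≤k =
      ℤP.<-trans (go m<n (ℕP.<⇒≤ n≤k)) (step (ℕP.≤-trans 1≤m (ℕP.<⇒≤ (ℕP.≤′⇒≤ m<n))) n≤k)

  rank-order : ∀ {m n} → 1 ℕ.≤ m → m ℕ.≤ k → 1 ℕ.≤ n → n ℕ.≤ k → (h m < h n) ⇔ (m ℕ.< n)
  rank-order {m} {n} 1≤m m≤k 1≤n n≤k = mk⇔ reflect (λ m<n → rank-mono 1≤m m<n n≤k)
    where
    reflect : h m < h n → m ℕ.< n
    reflect hm<hn with ℕP.<-cmp m n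
    ... | tri< m<n _ _  = m<n
    ... | tri≈ _ refl _ = ⊥-elim (ℤP.<-irrefl refl hm<hn)
    ... | tri> _ _ n<m  = ⊥-elim (ℤP.<-asym hm<hn (rank-mono 1≤n n<m m≤k))

_∈[1,_] : ℕ → ℕ → Set
r ∈[1, k ] = 1 ℕ.≤ r × r ℕ.≤ k

p132-ranks : All (_∈[1, 3 ]) p132
p132-ranks = from-yes (all? (λ r → 1 ℕ.≤? r ×-dec r ℕ.≤? 3) p132)

p2314-ranks : All (_∈[1, 4 ]) p2314
p2314-ranks = from-yes (all? (λ r → 1 ℕ.≤? r ×-dec r ℕ.≤? 4) p2314)

module _ {F : Forest} where

  -- An occurrence of π is built from its vertices listed by increasing label:
  -- position i holds the vertex of rank π(i).
  occurrence : ∀ {k} (π : Vec ℕ k) (byRank : ℕ → Vert F) → All (_∈[1, k ]) π →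
    (∀ {r} → 1 ℕ.≤ r → suc r ℕ.≤ k → L (byRank r) < L (byRank (suc r))) →
    Linked _≺_ (V.map byRank π) → Σ (Fin k → Vert F) (Instance F π)
  occurrence π byRank ranks step linked = byRank ∘ V.lookup π , consecutive , order
    where
    consecutive : ∀ i j → toℕ j ≡ suc (toℕ i) → byRank (V.lookup π i) ≺ byRank (V.lookup π j)
    consecutive i j j≡1+i = subst₂ _≺_ (lookup-map i byRank π) (lookup-map j byRank π)
      (lookup⁺ ≺-trans linked (ℕP.≤-reflexive (sym j≡1+i)))
    order : ∀ i j → (L (byRank (V.lookup π i)) < L (byRank (V.lookup π j))) ⇔ (V.lookup π i ℕ.< V.lookup π j)
    order i j with Allₚ.lookup⁺ ranks i | Allₚ.lookup⁺ ranks j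
    ... | 1≤πi , πi≤k | 1≤πj , πj≤k = rank-order (L ∘ byRank) step 1≤πi πi≤k 1≤πj πj≤k

  instance132 : {x y z : Vert F} → x ≺ y → y ≺ z → L x < L z → L z < L y →
    Σ (Fin 3 → Vert F) (Instance F p132)
  instance132 {x} {y} {z} x≺y y≺z x<z z<y =
    occurrence p132 byRank p132-ranks step (x≺y ∷ y≺z ∷ [-])
    where
    byRank : ℕ → Vert F
    byRank 2 = z
    byRank 3 = y
    byRank _ = x
    step : ∀ {r} → 1 ℕ.≤ r → suc r ℕ.≤ 3 → L (byRank r) < L (byRank (suc r))
    step {1} _ _ = x<z
    step {2} _ _ = z<y
    step {suc (suc (suc _))} _ (s≤s (s≤s (s≤s ())))

  instance2314 : {a b c d : Vert F} → a ≺ b → b ≺ c → c ≺ d → L c < L a → L a < L b → L b < L d →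
    Σ (Fin 4 → Vert F) (Instance F p2314)
  instance2314 {a} {b} {c} {d} a≺b b≺c c≺d c<a a<b b<d =
    occurrence p2314 byRank p2314-ranks step (a≺b ∷ b≺c ∷ c≺d ∷ [-])
    where
    byRank : ℕ → Vert F
    byRank 2 = a
    byRank 3 = b
    byRank 4 = d
    byRank _ = c
    step : ∀ {r} → 1 ℕ.≤ r → suc r ℕ.≤ 4 → L (byRank r) < L (byRank (suc r))
    step {1} _ _ = c<a
    step {2} _ _ = a<b
    step {3} _ _ = b<d
    step {suc (suc (suc (suc _)))} _ (s≤s (s≤s (s≤s (s≤s ()))))

  PatternFrom : Vert F → Vert F → Set
  PatternFrom v₁ v = Σ (Vert F) λ v₂ → Σ (Vert F) λ v₃ → Σ (Vert F) λ v₄ →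
    v₁ ≺ v₂ × v₂ ≺ v₃ × v₃ ≺ v₄ × v₄ ≼ v × TDM v₁ × ¬ TDM v₂ × TDM v₃ × ¬ TDM v₄

  PatternFrom⇒≼ : {v₁ v : Vert F} → PatternFrom v₁ v → v₁ ≼ v
  PatternFrom⇒≼ (_ , _ , _ , v₁≺v₂ , v₂≺v₃ , v₃≺v₄ , v₄≼v , _) =
    ≺⇒≼ (≺-≼-trans (≺-trans (≺-trans v₁≺v₂ v₂≺v₃) v₃≺v₄) v₄≼v)

  patternBelow : {u v₁ v : Vert F} → u ≼ v₁ → PatternFrom v₁ v → PatternBelow u v
  patternBelow u≼v₁ (v₂ , v₃ , v₄ , rest) = _ , v₂ , v₃ , v₄ , u≼v₁ , rest

  ceiling-pattern : {u v : Vert F} → Ceiling u v → PatternFrom u v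
  ceiling-pattern (_ , (v₁ , v₂ , v₃ , v₄ , u≼v₁ , rest) , maximal)
    with ≼-antisym u≼v₁ (maximal v₁ (PatternFrom⇒≼ from-v₁) (patternBelow (≼-refl v₁) from-v₁))
    where
    from-v₁ : PatternFrom v₁ _
    from-v₁ = v₂ , v₃ , v₄ , rest
  ... | refl = v₂ , v₃ , v₄ , rest

  -- The ceiling is found greedily from below: v₃ is the deepest TDM strict ancestor of v,
  -- v₂ the deepest non-TDM one above v₃, and v₁ the deepest TDM one above v₂.
  special⇒ceiling : {v : Vert F} → Special v → Σ (Vert F) λ u → Ceiling u v
  special⇒ceiling {v}
    (¬tdm , (w₁ , w₂ , w₃ , w₄ , _ , w₁≺w₂ , w₂≺w₃ , w₃≺w₄ , w₄≼v , tdm₁ , ¬tdm₂ , tdm₃ , _)) =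
    D₁.vertex , ≺⇒≼ v₁≺v , patternBelow (≼-refl D₁.vertex) v₁-pattern , maximal
    where
    module D₃ = DeepestBelow (deepestBelow TDM? (≺-≼-trans w₃≺w₄ w₄≼v) tdm₃)
    w₃≼v₃ : w₃ ≼ D₃.vertex
    w₃≼v₃ = D₃.deepest (≺-≼-trans w₃≺w₄ w₄≼v) tdm₃
    module D₂ = DeepestBelow (deepestBelow (¬? ∘ TDM?) (≺-≼-trans w₂≺w₃ w₃≼v₃) ¬tdm₂)
    w₂≼v₂ : w₂ ≼ D₂.vertex
    w₂≼v₂ = D₂.deepest (≺-≼-trans w₂≺w₃ w₃≼v₃) ¬tdm₂
    module D₁ = DeepestBelow (deepestBelow TDM? (≺-≼-trans w₁≺w₂ w₂≼v₂) tdm₁)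
    v₁≺v : D₁.vertex ≺ v
    v₁≺v = ≺-trans D₁.below (≺-trans D₂.below D₃.below)
    v₁-pattern : PatternFrom D₁.vertex v
    v₁-pattern = D₂.vertex , D₃.vertex , v , D₁.below , D₂.below , D₃.below , ≼-refl v ,
                 D₁.holds , D₂.holds , D₃.holds , ¬tdm
    maximal : ∀ w → w ≼ v → PatternBelow w v → w ≼ D₁.vertex
    maximal w _
      (x₁ , x₂ , x₃ , x₄ , w≼x₁ , x₁≺x₂ , x₂≺x₃ , x₃≺x₄ , x₄≼v , tdm-x₁ , ¬tdm-x₂ , tdm-x₃ , _) =
      ≼-trans w≼x₁ (D₁.deepest (≺-≼-trans x₁≺x₂ x₂≼v₂) tdm-x₁)
      where
      x₃≼v₃ : x₃ ≼ D₃.vertex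
      x₃≼v₃ = D₃.deepest (≺-≼-trans x₃≺x₄ x₄≼v) tdm-x₃
      x₂≼v₂ : x₂ ≼ D₂.vertex
      x₂≼v₂ = D₂.deepest (≺-≼-trans x₂≺x₃ x₃≼v₃) ¬tdm-x₂

  ceiling-TDM : {u v : Vert F} → Ceiling u v → TDM u
  ceiling-TDM ceiling with ceiling-pattern ceiling
  ... | _ , _ , _ , _ , _ , _ , _ , tdm-u , _ = tdm-u

  P₁⇒pattern-start≮end : P₁Forest F → {m v : Vert F} → PatternFrom m v → ¬ L m < L v
  P₁⇒pattern-start≮end P₁ {m} {v} m-pattern m<v = ℤP.<-asym (P₁ v u special ceiling) u<v
    where
    m≼v : m ≼ v
    m≼v = PatternFrom⇒≼ m-pattern
    special : Special v
    special = smaller-ancestor⇒¬TDM m≼v m<v , patternBelow (rootOf-≼ m≼v) m-pattern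
    u : Vert F
    u = proj₁ (special⇒ceiling special)
    ceiling : Ceiling u v
    ceiling = proj₂ (special⇒ceiling special)
    m≼u : m ≼ u
    m≼u = proj₂ (proj₂ ceiling) m m≼v (patternBelow (≼-refl m) m-pattern)
    u<v : L u < L v
    u<v = ℤP.≤-<-trans (ceiling-TDM ceiling m m≼u) m<v

module _ {F : Forest} (distinct : DistinctLabels F) where

  ≺⇒L≢ : {u v : Vert F} → u ≺ v → L u ≢ L v
  ≺⇒L≢ (_ , u≢v) = u≢v ∘ distinct

  TDM⇒< : {u v : Vert F} → u ≺ v → TDM v → L v < L u
  TDM⇒< u≺v tdm = ℤP.≤∧≢⇒< (tdm _ (≺⇒≼ u≺v)) (≺⇒L≢ u≺v ∘ sym)

  module _ (avoids132 : Avoids F p132) where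

    avoid132 : {x y z : Vert F} → x ≺ y → y ≺ z → L x < L z → L y < L z
    avoid132 x≺y y≺z x<z =
      ℤP.≤∧≢⇒< (ℤP.≮⇒≥ λ z<y → avoids132 (instance132 x≺y y≺z x<z z<y)) (≺⇒L≢ y≺z)

    avoids2314⇒P₁ : Avoids F p2314 → P₁Forest F
    avoids2314⇒P₁ avoids2314 v u _ ceiling@(_ , _ , maximal) with ceiling-pattern ceiling
    ... | v₂ , v₃ , v₄ , u≺v₂ , v₂≺v₃ , v₃≺v₄ , v₄≼v , tdm-u , ¬tdm₂ , tdm₃ , ¬tdm₄ =
      ℤP.≤∧≢⇒< (ℤP.≮⇒≥ λ u<v → avoids2314 (instance2314 u≺v₂ v₂≺v₃ v₃≺v v₃<u u<v₂ (v₂<v u<v)))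
               (≺⇒L≢ u≺v ∘ sym)
      where
      v₃≺v : v₃ ≺ v
      v₃≺v = ≺-≼-trans v₃≺v₄ v₄≼v
      u≺v : u ≺ v
      u≺v = ≺-trans (≺-trans u≺v₂ v₂≺v₃) v₃≺v
      v₃<u : L v₃ < L u
      v₃<u = TDM⇒< (≺-trans u≺v₂ v₂≺v₃) tdm₃
      u<v₂ : L u < L v₂
      u<v₂ with ¬TDM⇒smaller-TDM-ancestor ¬tdm₂
      ... | m , m≺v₂ , tdm-m , m<v₂ = ℤP.≤-<-trans (tdm-u m m≼u) m<v₂
        where
        m≼u : m ≼ u
        m≼u = maximal m (≺⇒≼ (≺-trans m≺v₂ (≺-trans v₂≺v₃ v₃≺v)))
                (patternBelow (≼-refl m)
                  (v₂ , v₃ , v₄ , m≺v₂ , v₂≺v₃ , v₃≺v₄ , v₄≼v , tdm-m , ¬tdm₂ , tdm₃ , ¬tdm₄))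
      v₂<v : L u < L v → L v₂ < L v
      v₂<v = avoid132 u≺v₂ (≺-trans v₂≺v₃ v₃≺v)

    2314⇒pattern : {a b c d : Vert F} → a ≺ b → b ≺ c → c ≺ d → L c < L a → L a < L b → L b < L d →
      Σ (Vert F) λ m → PatternFrom m d × L m < L d
    2314⇒pattern {a} {b} {c} {d} a≺b b≺c c≺d c<a a<b b<d with TDM-ancestor a | TDM-ancestor c
    ... | m , m≼a , tdm-m , m≤a | t , t≼c , tdm-t , t≤c =
      m , (b , t , d , ≼-≺-trans m≼a a≺b , b≺t , ≼-≺-trans t≼c c≺d , ≼-refl d ,
           tdm-m , ¬tdm-b , tdm-t , ¬tdm-d) , m<d
      where
      a<d : L a < L d
      a<d = ℤP.<-trans a<b b<d
      m<d : L m < L d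
      m<d = ℤP.≤-<-trans m≤a a<d
      ¬tdm-b : ¬ TDM b
      ¬tdm-b = smaller-ancestor⇒¬TDM (≺⇒≼ a≺b) a<b
      ¬tdm-d : ¬ TDM d
      ¬tdm-d = smaller-ancestor⇒¬TDM (≺⇒≼ (≺-trans a≺b (≺-trans b≺c c≺d))) a<d
      c<b : L c < L b
      c<b = ℤP.<-trans c<a a<b
      t<b : L t < L b
      t<b = ℤP.≤-<-trans t≤c c<b
      b≺t : b ≺ t
      b≺t with ≼-comparable t≼c (≺⇒≼ b≺c)
      ... | inj₂ b≼t = b≼t , λ { refl → ℤP.<-irrefl refl t<b }
      ... | inj₁ t≼b = ⊥-elim (ℤP.<-asym (avoid132 t≺b b≺c t<c) c<b)
        where
        t≺b : t ≺ b
        t≺b = <⇒≺ t≼b t<b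
        t<c : L t < L c
        t<c = ℤP.≤∧≢⇒< t≤c (≺⇒L≢ (≺-trans t≺b b≺c))

    P₁⇒avoids2314 : P₁Forest F → Avoids F p2314
    P₁⇒avoids2314 P₁ (x , consecutive , order) with
      2314⇒pattern (consecutive 0F 1F refl) (consecutive 1F 2F refl) (consecutive 2F 3F refl)
        (Equivalence.from (order 2F 0F) ℕP.≤-refl) (Equivalence.from (order 0F 1F) ℕP.≤-refl)
        (Equivalence.from (order 1F 3F) ℕP.≤-refl)
    ... | m , m-pattern , m<d = P₁⇒pattern-start≮end P₁ m-pattern m<d

lemma3p10 : (F : Forest) → DistinctLabels F → Avoids F p132 →
    (Avoids F p2314 ⇔ P₁Forest F)
lemma3p10 F distinct avoids132 =
  mk⇔ (avoids2314⇒P₁ distinct avoids132) (P₁⇒avoids2314 distinct avoids132)
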